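{- Let $k\geq 1$ be an integer and let $G=(X,Y,E)$ be a finite bipartite graph. Then $G$ is $k$-chordal bipartite if and only if both of the following hold: (i) $G$ is chordal bipartite; (ii) for each edge $e\in E$, the graph $G_e=(X,Y,E\setminus\{e\})$ obtained by deleting the edge $e$ is $(k-1)$-chordal bipartite.
   Context: Graphs are finite and simple. A bipartite graph $G=(X,Y,E)$ has disjoint vertex classes $X,Y$ with every edge joining $X$ to $Y$. A chord of a cycle $C$ is an edge of the graph joining two vertices of $C$ that is not an edge of $C$. A bipartite graph is chordal bipartite if every cycle of length at least $6$ has at least one chord. For an integer $k\geq 1$, a bipartite graph is $k$-chordal bipartite if every cycle of length at least $6$ has at least $k$ chords; by convention every bipartite graph is $0$-chordal bipartite. -}

module Defs where

open import Data.Nat using (ℕ; zero; suc; _≤_; _<_; _∸_)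
open import Data.Nat.Properties using (_<?_)
open import Data.Fin using (Fin; zero; suc; toℕ; fromℕ<; _≟_)
open import Data.Bool using (Bool; true; false; _∧_; not)
open import Data.List using (List; length; filterᵇ; cartesianProduct; allFin)
open import Data.Product using (_×_; _,_)
open import Function.Definitions using (Injective)
open import Relation.Binary.PropositionalEquality using (_≡_)
open import Relation.Nullary.Decidable using (⌊_⌋; yes; no)

-- A finite simple bipartite graph G = (X, Y, E) with X = Fin m, Y = Fin n;
-- the edge set is given by a Boolean adjacency relation between X and Y
-- (simplicity is automatic: at most one edge per pair x,y; no edges inside X or Y).
record BipGraph : Set where
  constructor bipGraph
  field
    m   : ℕ
    n   : ℕ
    adj : Fin m → Fin n → Bool
open BipGraph public

next : ∀ {p} → Fin (suc p) → Fin (suc p)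
next {p} i with suc (toℕ i) <? suc p
... | yes h = fromℕ< h
... | no _  = zero

-- A cycle of length 2·(suc p) in G: distinct vertices
--   x₀ y₀ x₁ y₁ … x_p y_p (x₀)
-- with edges xᵢyᵢ and y_i x_{i+1 mod (p+1)}.
-- (Every cycle of a bipartite graph has even length and alternates sides.)
record Cycle (G : BipGraph) (p : ℕ) : Set where
  field
    xs    : Fin (suc p) → Fin (m G)
    ys    : Fin (suc p) → Fin (n G)
    xsInj : Injective _≡_ _≡_ xs
    ysInj : Injective _≡_ _≡_ ys
    edge₁ : ∀ i → adj G (xs i) (ys i) ≡ true
    edge₂ : ∀ i → adj G (xs (next i)) (ys i) ≡ true
open Cycle public

-- The pair (xᵢ, yⱼ) is a chord of C: it is an edge of G but not an edge of C
-- (the cycle edges at xᵢ are xᵢyᵢ and xᵢy_{i-1}, i.e. j = i or next j = i).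
isChordᵇ : ∀ {G p} → Cycle G p → Fin (suc p) × Fin (suc p) → Bool
isChordᵇ {G} C (i , j) =
  adj G (xs C i) (ys C j) ∧ not ⌊ i ≟ j ⌋ ∧ not ⌊ i ≟ next j ⌋

-- number of chords of C (the vertices of C are distinct, so pairs (i,j)
-- correspond bijectively to X–Y vertex pairs of C; bipartite graphs have no
-- other possible chords)
chordCount : ∀ {G p} → Cycle G p → ℕ
chordCount {p = p} C =
  length (filterᵇ (isChordᵇ C) (cartesianProduct (allFin (suc p)) (allFin (suc p))))

-- G is k-chordal bipartite: every cycle of length ≥ 6 (i.e. 2·(suc p) with
-- suc p ≥ 3) has at least k chords.  For k = 0 this holds trivially.
KChordalBip : ℕ → BipGraph → Set
KChordalBip k G = ∀ (p : ℕ) → 3 ≤ suc p → (C : Cycle G p) → k ≤ chordCount C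

ChordalBip : BipGraph → Set
ChordalBip G = KChordalBip 1 G

deleteEdge : (G : BipGraph) → Fin (m G) → Fin (n G) → BipGraph
deleteEdge G x₀ y₀ =
  bipGraph (m G) (n G) (λ x y → adj G x y ∧ not (⌊ x ≟ x₀ ⌋ ∧ ⌊ y ≟ y₀ ⌋))

{-# OPTIONS --safe #-}
module Submission where

-- A cycle of G − xy is a cycle of G with the same vertices, and its chords in G − xy are its
-- chords in G except a chord joining x and y; as the vertices of a cycle are distinct, there
-- is at most one such chord. So a cycle of G − xy has at least k − 1 chords when G is
-- k-chordal bipartite. Conversely, a cycle C of length at least 6 in a chordal bipartite G
-- has a chord xy; C is then a cycle of G − xy, where it has at least k − 1 chords, and xy is
-- one more.

open import Defs
open import Data.Nat using (ℕ; _≤_; _∸_; suc; _+_; z≤n; s≤s)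
open import Data.Nat.Properties
  using (+-suc; +-comm; ≤-trans; ≤-antisym; +-monoʳ-≤; ∸-monoˡ-≤; m≤n+m∸n; module ≤-Reasoning)
open import Data.Fin using (Fin; _≟_)
open import Data.Bool using (Bool; true; false; _∧_; not; T)
open import Data.Bool.Properties using (∧-conicalˡ; ∧-conicalʳ; ∧-commutativeMonoid; T-≡)
open import Data.Product using (_×_; _,_; ∃; proj₁; proj₂)
open import Data.List using (List; []; _∷_; length; filterᵇ; cartesianProduct; allFin)
open import Data.List.Properties using (filter-≐; filter-some)
open import Data.List.Membership.Propositional using (_∈_; lose)
open import Data.List.Membership.Propositional.Properties
  using (∈-filter⁻; ∈-cartesianProduct⁺; ∈-allFin)
open import Data.List.Relation.Unary.Any using (here; there)
open import Data.List.Relation.Unary.AllPairs using (_∷_)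
open import Data.List.Relation.Unary.All using (_∷_)
open import Data.List.Relation.Unary.Unique.Propositional using (Unique)
import Data.List.Relation.Unary.Unique.Propositional.Properties as Unique
open import Algebra.Bundles using (CommutativeMonoid)
open import Algebra.Properties.CommutativeSemigroup
  (CommutativeMonoid.commutativeSemigroup ∧-commutativeMonoid) using (xy∙z≈xz∙y)
open import Data.Empty using (⊥-elim)
open import Function using (_∘_)
open import Function.Bundles using (_⇔_; mk⇔; Equivalence)
open import Relation.Nullary using (Dec; yes; no; ¬_)
open import Relation.Nullary.Decidable using (⌊_⌋; T?)
open import Relation.Binary.PropositionalEquality
  using (_≡_; _≢_; refl; sym; trans; cong; cong₂; subst; module ≡-Reasoning)

module _ {A : Set} where

  filterᵇ-cong : ∀ {f g : A → Bool} → (∀ a → f a ≡ g a) → ∀ xs → filterᵇ f xs ≡ filterᵇ g xs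
  filterᵇ-cong {f} {g} f≗g =
    filter-≐ (T? ∘ f) (T? ∘ g) ((λ {a} → subst T (f≗g a)) , (λ {a} → subst T (sym (f≗g a))))

  length-filterᵇ-split : ∀ (f h : A → Bool) xs →
    length (filterᵇ f xs) ≡
      length (filterᵇ (λ a → f a ∧ not (h a)) xs) + length (filterᵇ (λ a → f a ∧ h a) xs)
  length-filterᵇ-split f h [] = refl
  length-filterᵇ-split f h (x ∷ xs) with f x | h x
  ... | true  | true  = trans (cong suc (length-filterᵇ-split f h xs)) (sym (+-suc _ _))
  ... | true  | false = cong suc (length-filterᵇ-split f h xs)
  ... | false | _     = length-filterᵇ-split f h xs

  length≤1 : ∀ {xs : List A} → Unique xs → (∀ {a b} → a ∈ xs → b ∈ xs → a ≡ b) → length xs ≤ 1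
  length≤1 {[]}        _               _    = z≤n
  length≤1 {_ ∷ []}    _               _    = s≤s z≤n
  length≤1 {_ ∷ _ ∷ _} ((x≢y ∷ _) ∷ _) all≡ = ⊥-elim (x≢y (all≡ (here refl) (there (here refl))))

  length-filterᵇ≤1 : ∀ (f : A → Bool) {xs} → Unique xs →
    (∀ {a b} → f a ≡ true → f b ≡ true → a ≡ b) → length (filterᵇ f xs) ≤ 1
  length-filterᵇ≤1 f {xs} xs! f-inj =
    length≤1 (Unique.filter⁺ (T? ∘ f) xs!) (λ a∈ b∈ → f-inj (holds a∈) (holds b∈))
    where
    holds : ∀ {a} → a ∈ filterᵇ f xs → f a ≡ true
    holds = Equivalence.to T-≡ ∘ proj₂ ∘ ∈-filter⁻ (T? ∘ f) {xs = xs}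

  1≤length-filterᵇ : ∀ (f : A → Bool) {a xs} → a ∈ xs → f a ≡ true → 1 ≤ length (filterᵇ f xs)
  1≤length-filterᵇ f a∈ fa = filter-some (T? ∘ f) (lose a∈ (Equivalence.from T-≡ fa))

  filterᵇ-witness : ∀ (f : A → Bool) xs → 1 ≤ length (filterᵇ f xs) → ∃ λ a → f a ≡ true
  filterᵇ-witness f (x ∷ xs) 1≤ with f x in fx
  ... | true  = x , fx
  ... | false = filterᵇ-witness f xs 1≤

⌊⌋≡true : ∀ {P : Set} (P? : Dec P) → P → ⌊ P? ⌋ ≡ true
⌊⌋≡true (yes _) _  = refl
⌊⌋≡true (no ¬p) p = ⊥-elim (¬p p)

module _ {G : BipGraph} {x₀ : Fin (m G)} {y₀ : Fin (n G)} where

  adj-deleteEdge⁻ : ∀ {x y} → adj (deleteEdge G x₀ y₀) x y ≡ true → adj G x y ≡ true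
  adj-deleteEdge⁻ = ∧-conicalˡ _ _

  adj-deleteEdge⁺ : ∀ {x y} → adj G x y ≡ true → ¬ (x ≡ x₀ × y ≡ y₀) →
    adj (deleteEdge G x₀ y₀) x y ≡ true
  adj-deleteEdge⁺ {x} {y} xy rewrite xy with x ≟ x₀ | y ≟ y₀
  ... | yes x≡x₀ | yes y≡y₀ = λ ≢e → ⊥-elim (≢e (x≡x₀ , y≡y₀))
  ... | yes _    | no _     = λ _ → refl
  ... | no _     | _        = λ _ → refl

  liftCycle : ∀ {p} → Cycle (deleteEdge G x₀ y₀) p → Cycle G p
  liftCycle C = record
    { xs = xs C ; ys = ys C ; xsInj = xsInj C ; ysInj = ysInj C
    ; edge₁ = adj-deleteEdge⁻ ∘ edge₁ C
    ; edge₂ = adj-deleteEdge⁻ ∘ edge₂ C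
    }

indexPairs : (p : ℕ) → List (Fin (suc p) × Fin (suc p))
indexPairs p = cartesianProduct (allFin (suc p)) (allFin (suc p))

indexPairs-unique : ∀ p → Unique (indexPairs p)
indexPairs-unique p = Unique.cartesianProduct⁺ (Unique.allFin⁺ (suc p)) (Unique.allFin⁺ (suc p))

module _ {G : BipGraph} {p : ℕ} (C : Cycle G p) where

  isChordᵇ⇒ : ∀ {i j} → isChordᵇ C (i , j) ≡ true →
    adj G (xs C i) (ys C j) ≡ true × i ≢ j × i ≢ next j
  isChordᵇ⇒ {i} {j} chord with adj G (xs C i) (ys C j) | i ≟ j | i ≟ next j
  isChordᵇ⇒ refl | true | no i≢j | no i≢j⁺ = refl , i≢j , i≢j⁺

  joinsᵇ : Fin (m G) → Fin (n G) → Fin (suc p) × Fin (suc p) → Bool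
  joinsᵇ x₀ y₀ (i , j) = ⌊ xs C i ≟ x₀ ⌋ ∧ ⌊ ys C j ≟ y₀ ⌋

  joinsᵇ⇒ : ∀ {x₀ y₀ i j} → joinsᵇ x₀ y₀ (i , j) ≡ true → xs C i ≡ x₀ × ys C j ≡ y₀
  joinsᵇ⇒ {x₀} {y₀} {i} {j} joins with xs C i ≟ x₀ | ys C j ≟ y₀
  joinsᵇ⇒ refl | yes x≡x₀ | yes y≡y₀ = x≡x₀ , y≡y₀

  joinsᵇ-self : ∀ {i j} → joinsᵇ (xs C i) (ys C j) (i , j) ≡ true
  joinsᵇ-self {i} {j} = cong₂ _∧_ (⌊⌋≡true (xs C i ≟ xs C i) refl) (⌊⌋≡true (ys C j ≟ ys C j) refl)

  joinsᵇ-injective : ∀ {x₀ y₀ q q′} → joinsᵇ x₀ y₀ q ≡ true → joinsᵇ x₀ y₀ q′ ≡ true → q ≡ q′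
  joinsᵇ-injective {q = i , j} {i′ , j′} joins joins′
    with joinsᵇ⇒ joins | joinsᵇ⇒ joins′
  ... | x , y | x′ , y′
    rewrite xsInj C (trans x (sym x′)) | ysInj C (trans y (sym y′)) = refl

  chordCountAt : Fin (m G) → Fin (n G) → ℕ
  chordCountAt x₀ y₀ = length (filterᵇ (λ q → isChordᵇ C q ∧ joinsᵇ x₀ y₀ q) (indexPairs p))

  chordCountAt≤1 : ∀ x₀ y₀ → chordCountAt x₀ y₀ ≤ 1
  chordCountAt≤1 x₀ y₀ = length-filterᵇ≤1 _ (indexPairs-unique p)
    λ {q} {q′} c c′ → joinsᵇ-injective (∧-conicalʳ (isChordᵇ C q) _ c) (∧-conicalʳ (isChordᵇ C q′) _ c′)

  chord⇒1≤chordCountAt : ∀ {i j} → isChordᵇ C (i , j) ≡ true → 1 ≤ chordCountAt (xs C i) (ys C j)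
  chord⇒1≤chordCountAt {i} {j} chord =
    1≤length-filterᵇ (λ q → isChordᵇ C q ∧ joinsᵇ (xs C i) (ys C j) q)
      (∈-cartesianProduct⁺ (∈-allFin i) (∈-allFin j))
      (cong₂ _∧_ chord joinsᵇ-self)

module _ {G : BipGraph} {x₀ : Fin (m G)} {y₀ : Fin (n G)} {p : ℕ}
         (C′ : Cycle (deleteEdge G x₀ y₀) p) where

  chordCount-liftCycle : chordCount (liftCycle C′) ≡ chordCount C′ + chordCountAt (liftCycle C′) x₀ y₀
  chordCount-liftCycle = begin
    chordCount C
      ≡⟨ length-filterᵇ-split (isChordᵇ C) (joinsᵇ C x₀ y₀) (indexPairs p) ⟩
    length (filterᵇ (λ q → isChordᵇ C q ∧ not (joinsᵇ C x₀ y₀ q)) (indexPairs p)) + chordCountAt C x₀ y₀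
      ≡⟨ cong (λ chords → length chords + chordCountAt C x₀ y₀) (filterᵇ-cong chord-in-C′ (indexPairs p)) ⟩
    chordCount C′ + chordCountAt C x₀ y₀ ∎
    where
    open ≡-Reasoning
    C : Cycle G p
    C = liftCycle C′
    chord-in-C′ : ∀ q → isChordᵇ C q ∧ not (joinsᵇ C x₀ y₀ q) ≡ isChordᵇ C′ q
    chord-in-C′ (i , j) = sym (xy∙z≈xz∙y (adj G (xs C i) (ys C j)) _ _)

  chordCount-liftCycle≤ : chordCount (liftCycle C′) ≤ suc (chordCount C′)
  chordCount-liftCycle≤ = begin
    chordCount (liftCycle C′)                          ≡⟨ chordCount-liftCycle ⟩
    chordCount C′ + chordCountAt (liftCycle C′) x₀ y₀  ≤⟨ +-monoʳ-≤ _ (chordCountAt≤1 (liftCycle C′) x₀ y₀) ⟩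
    chordCount C′ + 1                                  ≡⟨ +-comm _ 1 ⟩
    suc (chordCount C′)                                ∎
    where open ≤-Reasoning

module _ {G : BipGraph} {p : ℕ} (C : Cycle G p) {a b : Fin (suc p)}
         (chord : isChordᵇ C (a , b) ≡ true) where

  deleteChord : Cycle (deleteEdge G (xs C a) (ys C b)) p
  deleteChord = record
    { xs = xs C ; ys = ys C ; xsInj = xsInj C ; ysInj = ysInj C
    ; edge₁ = λ i → delete (edge₁ C i)
        λ (x≡ , y≡) → a≢b (trans (sym (xsInj C x≡)) (ysInj C y≡))
    ; edge₂ = λ i → delete (edge₂ C i)
        λ (x≡ , y≡) → a≢next-b (trans (sym (xsInj C x≡)) (cong next (ysInj C y≡)))
    }
    where
    delete : ∀ {x y} → adj G x y ≡ true → ¬ (x ≡ xs C a × y ≡ ys C b) →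
      adj (deleteEdge G (xs C a) (ys C b)) x y ≡ true
    delete = adj-deleteEdge⁺ {G = G}
    a≢b : a ≢ b
    a≢b = proj₁ (proj₂ (isChordᵇ⇒ C chord))
    a≢next-b : a ≢ next b
    a≢next-b = proj₂ (proj₂ (isChordᵇ⇒ C chord))

  -- liftCycle deleteChord has the vertex maps of C, so it has the chord counts of C by computation.
  chordCount-deleteChord : suc (chordCount deleteChord) ≡ chordCount C
  chordCount-deleteChord = begin
    suc (chordCount deleteChord)                               ≡⟨ +-comm 1 _ ⟩
    chordCount deleteChord + 1                                 ≡⟨ cong (chordCount deleteChord +_) at≡1 ⟨
    chordCount deleteChord + chordCountAt C (xs C a) (ys C b)  ≡⟨ chordCount-liftCycle deleteChord ⟨
    chordCount C                                               ∎
    where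
    open ≡-Reasoning
    at≡1 : chordCountAt C (xs C a) (ys C b) ≡ 1
    at≡1 = ≤-antisym (chordCountAt≤1 C _ _) (chord⇒1≤chordCountAt C chord)

EdgeDeletedKChordalBip : ℕ → BipGraph → Set
EdgeDeletedKChordalBip k G =
  (x : Fin (m G)) → (y : Fin (n G)) → adj G x y ≡ true → KChordalBip k (deleteEdge G x y)

theorem4p1 : (k : ℕ) → 1 ≤ k → (G : BipGraph) →
    KChordalBip k G ⇔
      (ChordalBip G ×
        ((x : Fin (m G)) → (y : Fin (n G)) → adj G x y ≡ true →
          KChordalBip (k ∸ 1) (deleteEdge G x y)))
theorem4p1 k 1≤k G = mk⇔ forward backward
  where
  forward : KChordalBip k G → ChordalBip G × EdgeDeletedKChordalBip (k ∸ 1) G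
  forward k-chordal =
      (λ p 3≤ C → ≤-trans 1≤k (k-chordal p 3≤ C))
    , λ x y _ p 3≤ C′ → ∸-monoˡ-≤ 1 (≤-trans (k-chordal p 3≤ (liftCycle C′)) (chordCount-liftCycle≤ C′))

  backward : ChordalBip G × EdgeDeletedKChordalBip (k ∸ 1) G → KChordalBip k G
  backward (chordal , deletions-chordal) p 3≤ C
    with filterᵇ-witness (isChordᵇ C) (indexPairs p) (chordal p 3≤ C)
  ... | (a , b) , chord = begin
    k                    ≤⟨ m≤n+m∸n k 1 ⟩
    suc (k ∸ 1)          ≤⟨ s≤s (deletions-chordal _ _ (proj₁ (isChordᵇ⇒ C chord)) p 3≤ C′) ⟩
    suc (chordCount C′)  ≡⟨ chordCount-deleteChord C chord ⟩
    chordCount C         ∎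
    where
    open ≤-Reasoning
    C′ : Cycle (deleteEdge G (xs C a) (ys C b)) p
    C′ = deleteChord C chord
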